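{- The properties $\neg\mathrm{UN}$, $\neg\mathrm{UN}^{\to}$ and $\neg\mathrm{NFP}$ of abstract rewrite systems are not generalised first-order properties.
   Context: An ARS is a pair $(A,\to)$, $A$ non-empty, ${\to}\subseteq A\times A$; $\twoheadrightarrow$ is the reflexive transitive closure and $\leftrightarrow^*$ the reflexive transitive closure of ${\to}\cup{\leftarrow}$. An element $a$ is a normal form if there is no $b$ with $a\to b$. The ARS has UN if for all normal forms $a,b$, $a\leftrightarrow^*b$ implies $a=b$; it has $\mathrm{UN}^{\to}$ if for all normal forms $a,b$, ($\exists x$. $x\twoheadrightarrow a$ and $x\twoheadrightarrow b$) implies $a=b$; it has NFP if for all $a\in A$ and all normal forms $b$, $a\leftrightarrow^*b$ implies $a\twoheadrightarrow b$. $\neg P$ denotes the property of not having $P$. A property $P$ of ARSs is a generalised first-order property if there is a set $\Phi$ of sentences of first-order logic with equality and a single binary predicate symbol $\to$ (interpreted as the one-step relation) such that for every ARS $\mathcal{A}$, $\mathcal{A}$ has $P$ iff $\mathcal{A}\models\Phi$. -}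

module Defs where

open import Data.Nat using (ℕ; suc)
open import Data.Fin using (Fin; zero; suc)
open import Data.Empty using (⊥)
open import Data.Unit using (⊤)
open import Data.Product using (Σ; ∃; _×_; _,_)
open import Data.Sum using (_⊎_)
open import Relation.Nullary using (¬_)
open import Relation.Binary.PropositionalEquality using (_≡_)
open import Relation.Binary.Construct.Closure.ReflexiveTransitive using (Star)
open import Relation.Binary.Construct.Closure.Symmetric using (SymClosure)
open import Function.Bundles using (_⇔_)

record ARS : Set₁ where
  field
    Carrier  : Set
    _⟶_      : Carrier → Carrier → Set
    nonEmpty : Carrier

module _ (𝒜 : ARS) where
  open ARS 𝒜

  _↠_ : Carrier → Carrier → Set
  _↠_ = Star _⟶_

  _↔*_ : Carrier → Carrier → Set
  _↔*_ = Star (SymClosure _⟶_)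

  IsNF : Carrier → Set
  IsNF a = ¬ (Σ Carrier λ b → a ⟶ b)

  UN : Set
  UN = ∀ a b → IsNF a → IsNF b → a ↔* b → a ≡ b

  UN→ : Set
  UN→ = ∀ a b → IsNF a → IsNF b → (Σ Carrier λ x → (x ↠ a) × (x ↠ b)) → a ≡ b

  NFP : Set
  NFP = ∀ a b → IsNF b → a ↔* b → a ↠ b

Property : Set₁
Property = ARS → Set

¬UN ¬UN→ ¬NFP : Property
¬UN  𝒜 = ¬ UN 𝒜
¬UN→ 𝒜 = ¬ UN→ 𝒜
¬NFP 𝒜 = ¬ NFP 𝒜

data Formula : ℕ → Set where
  ⊥'   : ∀ {n} → Formula n
  ⊤'   : ∀ {n} → Formula n
  _≐_  : ∀ {n} → Fin n → Fin n → Formula n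
  rel  : ∀ {n} → Fin n → Fin n → Formula n
  ¬'_  : ∀ {n} → Formula n → Formula n
  _∧'_ : ∀ {n} → Formula n → Formula n → Formula n
  _∨'_ : ∀ {n} → Formula n → Formula n → Formula n
  _⇒'_ : ∀ {n} → Formula n → Formula n → Formula n
  ∀'   : ∀ {n} → Formula (suc n) → Formula n
  ∃'   : ∀ {n} → Formula (suc n) → Formula n

Sentence : Set
Sentence = Formula 0

module _ (𝒜 : ARS) where
  open ARS 𝒜

  extend : ∀ {n} → Carrier → (Fin n → Carrier) → Fin (suc n) → Carrier
  extend a ρ zero    = a
  extend a ρ (suc i) = ρ i

  ⟦_⟧ : ∀ {n} → Formula n → (Fin n → Carrier) → Set
  ⟦ ⊥' ⟧     ρ = ⊥
  ⟦ ⊤' ⟧     ρ = ⊤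
  ⟦ i ≐ j ⟧  ρ = ρ i ≡ ρ j
  ⟦ rel i j ⟧ ρ = ρ i ⟶ ρ j
  ⟦ ¬' φ ⟧   ρ = ¬ ⟦ φ ⟧ ρ
  ⟦ φ ∧' ψ ⟧ ρ = ⟦ φ ⟧ ρ × ⟦ ψ ⟧ ρ
  ⟦ φ ∨' ψ ⟧ ρ = ⟦ φ ⟧ ρ ⊎ ⟦ ψ ⟧ ρ
  ⟦ φ ⇒' ψ ⟧ ρ = ⟦ φ ⟧ ρ → ⟦ ψ ⟧ ρ
  ⟦ ∀' φ ⟧   ρ = (a : Carrier) → ⟦ φ ⟧ (extend a ρ)
  ⟦ ∃' φ ⟧   ρ = Σ Carrier λ a → ⟦ φ ⟧ (extend a ρ)

  _⊨_ : Sentence → Set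
  _⊨_ φ = ⟦ φ ⟧ (λ ())

  _⊨Th_ : (Sentence → Set) → Set
  _⊨Th_ Φ = ∀ φ → Φ φ → _⊨_ φ

GeneralisedFO : Property → Set₁
GeneralisedFO P = Σ (Sentence → Set) λ Φ → ∀ 𝒜 → P 𝒜 ⇔ _⊨Th_ 𝒜 Φ

-- For M ≥ 2 let A_M be the ARS made of a segment 0, 1, …, M, whose inner points step to both
-- neighbours so that the two ends are distinct convertible normal forms, together with infinitely
-- many rays ending in a normal form on either side; it has ¬UN, ¬UN→ and ¬NFP. The ARS B of the
-- rays alone has UN, UN→ and NFP. An Ehrenfeucht–Fraïssé argument shows that A_M and B satisfy the
-- same sentences of quantifier rank k once M ≥ 2^(k+1): a partial isomorphism with threshold t
-- matches points of equal coordinate that agree, within distance t of either anchor 0 or M, on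
-- which ends their component has, and it keeps t apart any two points that share a component on
-- one side only. Such a map extends by one point at threshold t/2, by placing the image on the
-- component of a chosen point within distance t/2, or otherwise on a fresh ray. So a set of
-- sentences axiomatising ¬P, each true in some A_M, would hold in B, which has P.

module Submission where

open import Defs
open import Data.Product using (_×_)
open import Relation.Nullary using (¬_)

open import Data.Empty using (⊥-elim)
open import Data.Fin using (Fin; zero; suc)
open import Data.Fin.Properties using (any?)
open import Data.Integer as ℤ using (ℤ; +_; -[1+_]; 0ℤ; ∣_∣; _-_)
import Data.Integer.Properties as ℤP
open import Data.Integer.Tactic.RingSolver using (solve-∀)
open import Data.Maybe using (Maybe; nothing; just)
import Data.Maybe.Properties as MaybeP
open import Data.Nat using (ℕ; zero; suc; z≤n; s≤s; _+_; _≤_; _<_; _⊔_)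
import Data.Nat.Properties as ℕP
open import Data.Product using (Σ; _,_; proj₁; proj₂)
import Data.Product.Properties as ProductP
open import Data.Sum using (inj₁; inj₂)
open import Data.Unit using (⊤; tt)
open import Function.Bundles using (_⇔_; mk⇔; Equivalence)
open import Function.Construct.Identity using (⇔-id)
open import Function.Construct.Symmetry using (⇔-sym)
open import Relation.Binary.Construct.Closure.ReflexiveTransitive using (ε; _◅_; _◅◅_; gmap)
open import Relation.Binary.Construct.Closure.Symmetric using (fwd; bwd)
open import Relation.Binary.Definitions using (DecidableEquality)
open import Relation.Binary.PropositionalEquality
open import Relation.Nullary using (Dec; yes; no; contradiction)
open import Relation.Nullary.Decidable using (_×-dec_)

dist : ℤ → ℤ → ℕ
dist a b = ∣ a - b ∣

dist-sym : ∀ a b → dist a b ≡ dist b a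
dist-sym = ℤP.∣i-j∣≡∣j-i∣

dist-self : ∀ a → dist a a ≡ 0
dist-self a = cong ∣_∣ (ℤP.+-inverseʳ a)

dist-triangle : ∀ a b c → dist a c ≤ dist a b + dist b c
dist-triangle a b c =
  subst (λ z → ∣ z ∣ ≤ dist a b + dist b c) (sym (split a b c)) (ℤP.∣i+j∣≤∣i∣+∣j∣ (a - b) (b - c))
  where
  split : ∀ a b c → a - c ≡ (a - b) ℤ.+ (b - c)
  split = solve-∀

dist-between : ∀ {a b c} → a ℤ.≤ b → b ℤ.≤ c → dist c b ≤ dist c a × dist b a ≤ dist c a
dist-between {a} {b} {c} a≤b b≤c = subst (λ z → dist c b ≤ ∣ z ∣ × dist b a ≤ ∣ z ∣) (sym (split a b c))
  ( ∣i∣≤∣i+j∣ (ℤP.i≤j⇒0≤j-i b≤c) (ℤP.i≤j⇒0≤j-i a≤b)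
  , subst (dist b a ≤_) (cong ∣_∣ (ℤP.+-comm (b - a) (c - b)))
      (∣i∣≤∣i+j∣ (ℤP.i≤j⇒0≤j-i a≤b) (ℤP.i≤j⇒0≤j-i b≤c)))
  where
  split : ∀ a b c → c - a ≡ (c - b) ℤ.+ (b - a)
  split = solve-∀
  ∣i∣≤∣i+j∣ : ∀ {i j} → 0ℤ ℤ.≤ i → 0ℤ ℤ.≤ j → ∣ i ∣ ≤ ∣ i ℤ.+ j ∣
  ∣i∣≤∣i+j∣ {+ m} {+ n} _ _ = ℕP.m≤m+n m n

dist-suc : ∀ d → dist (+ suc d) (+ d) ≡ 1
dist-suc d = cong ∣_∣ (trans (cong (_- + d) (ℤP.pos-+ 1 d)) (step (+ d)))
  where
  step : ∀ x → (+ 1 ℤ.+ x) - x ≡ + 1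
  step = solve-∀

dist-reflect : ∀ m a b → dist (m - a) (m - b) ≡ dist a b
dist-reflect m a b = trans (cong ∣_∣ (reflect a b m)) (dist-sym b a)
  where
  reflect : ∀ a b m → (m - a) - (m - b) ≡ b - a
  reflect = solve-∀

dist-from-0 : ∀ n → dist 0ℤ (+ n) ≡ n
dist-from-0 n = trans (cong ∣_∣ (ℤP.+-identityˡ (ℤ.- + n))) (ℤP.∣-i∣≡∣i∣ (+ n))

reflect-involutive : ∀ m x → m - (m - x) ≡ x
reflect-involutive = solve-∀

far-from-near : ∀ {t} a b c → t + t ≤ dist a b → dist c a < t → t ≤ dist c b
far-from-near {t} a b c far near = ℕP.≮⇒≥ λ c-near-b → ℕP.<⇒≱ (begin-strict
  dist a b            ≤⟨ dist-triangle a c b ⟩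
  dist a c + dist c b <⟨ ℕP.+-mono-< (subst (_< t) (dist-sym c a) near) c-near-b ⟩
  t + t               ∎) far
  where open ℕP.≤-Reasoning

data End : Set where
  left right : End

_≟ᴱ_ : DecidableEquality End
left  ≟ᴱ left  = yes refl
left  ≟ᴱ right = no λ ()
right ≟ᴱ left  = no λ ()
right ≟ᴱ right = yes refl

data Ends : Set where
  only : End → Ends
  both : Ends

_∈ᴱ_ : End → Ends → Set
e ∈ᴱ only e₀ = e ≡ e₀
e ∈ᴱ both = ⊤

anchor : ℕ → End → ℤ
anchor M left  = 0ℤ
anchor M right = + M

OnSide : ℕ → End → ℤ → Set
OnSide M left  c = 0ℤ ℤ.≤ c
OnSide M right c = c ℤ.≤ + M

onSide? : ∀ M e c → Dec (OnSide M e c)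
onSide? M left  c = 0ℤ ℤP.≤? c
onSide? M right c = c ℤP.≤? + M

anchor-closer : ∀ M e {c c′} → ¬ OnSide M e c → OnSide M e c′ → dist c′ (anchor M e) ≤ dist c′ c
anchor-closer M left  ¬c 0≤c′ = proj₁ (dist-between (ℤP.<⇒≤ (ℤP.≰⇒> ¬c)) 0≤c′)
anchor-closer M right {c} {c′} ¬c c′≤M =
  subst₂ _≤_ (dist-sym (+ M) c′) (dist-sym c c′) (proj₂ (dist-between c′≤M (ℤP.<⇒≤ (ℤP.≰⇒> ¬c))))

near-both-anchors : ∀ {M t} c → dist c (anchor M left) < t → dist c (anchor M right) < t → M < t + t
near-both-anchors {M} {t} c near-left near-right = begin-strict
  M                              ≡⟨ dist-from-0 M ⟨
  dist 0ℤ (+ M)                  ≤⟨ dist-triangle 0ℤ c (+ M) ⟩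
  dist 0ℤ c + dist c (+ M)       <⟨ ℕP.+-mono-< (subst (_< t) (dist-sym c 0ℤ) near-left) near-right ⟩
  t + t                          ∎
  where open ℕP.≤-Reasoning

Endpoint : ℕ → Ends → ℤ → Set
Endpoint M E c = Σ End λ e → e ∈ᴱ E × c ≡ anchor M e

LineStep : ℕ → Ends → ℤ → ℤ → Set
LineStep M E c c′ = dist c c′ ≡ 1 × ¬ Endpoint M E c

SameNearEnds : ℕ → ℕ → ℤ → Ends → Ends → Set
SameNearEnds M t c E E′ = ∀ e → dist c (anchor M e) < t → e ∈ᴱ E ⇔ e ∈ᴱ E′

sameNearEnds-oneEnded : ∀ {M t} → t + t ≤ M → ∀ E c → Σ End λ e₀ → e₀ ∈ᴱ E × SameNearEnds M t c E (only e₀)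
sameNearEnds-oneEnded _ (only e₀) c = e₀ , refl , λ _ _ → ⇔-id _
sameNearEnds-oneEnded {M} {t} 2t≤M both c with dist c (anchor M right) ℕP.<? t
... | yes near-right = right , tt , onlyRight
  where
  onlyRight : SameNearEnds M t c both (only right)
  onlyRight left  near-left = contradiction 2t≤M (ℕP.<⇒≱ (near-both-anchors c near-left near-right))
  onlyRight right _         = mk⇔ (λ _ → refl) (λ _ → tt)
... | no far-right = left , tt , onlyLeft
  where
  onlyLeft : SameNearEnds M t c both (only left)
  onlyLeft left  _          = mk⇔ (λ _ → refl) (λ _ → tt)
  onlyLeft right near-right = contradiction near-right far-right

-- Components are lines in ℤ, walked in both directions except from the anchors of their ends;
-- A_M and B are both of this shape.
record LineSystem (M : ℕ) : Set₁ where
  field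
    Point     : Set
    _⟶_       : Point → Point → Set
    origin    : Point
    Component : Set
    _≟_       : DecidableEquality Component
    component : Point → Component
    coord     : Point → ℤ
    ends      : Component → Ends

  endsOf : Point → Ends
  endsOf x = ends (component x)

  field
    coord-onSide : ∀ x {e} → e ∈ᴱ endsOf x → OnSide M e (coord x)
    place        : ∀ k c → (∀ {e} → e ∈ᴱ ends k → OnSide M e c) →
                   Σ Point λ x → component x ≡ k × coord x ≡ c
    point-ext    : ∀ {x y} → component x ≡ component y → coord x ≡ coord y → x ≡ y
    ⟶⇔           : ∀ {x y} → x ⟶ y ⇔ (component x ≡ component y × LineStep M (endsOf x) (coord x) (coord y))
    fresh        : ∀ {n} (σ : Fin n → Point) e → Σ Component λ k → ends k ≡ only e × ∀ i → component (σ i) ≢ k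

  ars : ARS
  ars = record { Carrier = Point ; _⟶_ = _⟶_ ; nonEmpty = origin }

module _ {M : ℕ} where
  open LineSystem

  Matched : (X Y : LineSystem M) → ℕ → Point X → Point Y → Set
  Matched X Y t x y = coord X x ≡ coord Y y × SameNearEnds M t (coord X x) (endsOf X x) (endsOf Y y)

  Apart : (X Y : LineSystem M) → ℕ → Point X → Point X → Point Y → Point Y → Set
  Apart X Y t x x′ y y′ =
    component X x ≡ component X x′ → component Y y ≢ component Y y′ → t ≤ dist (coord X x) (coord X x′)

  record PartialIso (X Y : LineSystem M) (t : ℕ) {n : ℕ} (ρ : Fin n → Point X) (σ : Fin n → Point Y) : Set where
    field
      matched : ∀ i → Matched X Y t (ρ i) (σ i)
      apart→  : ∀ i j → Apart X Y t (ρ i) (ρ j) (σ i) (σ j)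
      apart←  : ∀ i j → Apart Y X t (σ i) (σ j) (ρ i) (ρ j)

  open PartialIso

  matched-sym : ∀ X Y {t x y} → Matched X Y t x y → Matched Y X t y x
  matched-sym X Y {t} (x≡y , same) =
    sym x≡y , λ e near → ⇔-sym (same e (subst (λ c → dist c (anchor M e) < t) (sym x≡y) near))

  matched-mono : ∀ X Y {t t′ x y} → t′ ≤ t → Matched X Y t x y → Matched X Y t′ x y
  matched-mono X Y t′≤t (x≡y , same) = x≡y , λ e near → same e (ℕP.<-≤-trans near t′≤t)

  apart-swap : ∀ X Y {t x x′ y y′} → Apart X Y t x x′ y y′ → Apart X Y t x′ x y′ y
  apart-swap X Y {t} {x} {x′} apart x′~x y′≁y =
    subst (t ≤_) (dist-sym (coord X x) (coord X x′)) (apart (sym x′~x) (λ y~y′ → y′≁y (sym y~y′)))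

  apart-mono : ∀ X Y {t t′ x x′ y y′} → t′ ≤ t → Apart X Y t x x′ y y′ → Apart X Y t′ x x′ y y′
  apart-mono X Y t′≤t apart x~x′ y≁y′ = ℕP.≤-trans t′≤t (apart x~x′ y≁y′)

  partialIso-sym : ∀ X Y {t n} {ρ : Fin n → Point X} {σ : Fin n → Point Y} →
                   PartialIso X Y t ρ σ → PartialIso Y X t σ ρ
  partialIso-sym X Y iso = record
    { matched = λ i → matched-sym X Y (matched iso i)
    ; apart→  = apart← iso
    ; apart←  = apart→ iso
    }

  partialIso-mono : ∀ X Y {t t′ n} {ρ : Fin n → Point X} {σ : Fin n → Point Y} →
                    t′ ≤ t → PartialIso X Y t ρ σ → PartialIso X Y t′ ρ σ
  partialIso-mono X Y t′≤t iso = record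
    { matched = λ i → matched-mono X Y t′≤t (matched iso i)
    ; apart→  = λ i j → apart-mono X Y t′≤t (apart→ iso i j)
    ; apart←  = λ i j → apart-mono Y X t′≤t (apart← iso i j)
    }

  partialIso-empty : ∀ X Y {t} {ρ : Fin 0 → Point X} {σ : Fin 0 → Point Y} → PartialIso X Y t ρ σ
  partialIso-empty X Y = record { matched = λ () ; apart→ = λ () ; apart← = λ () }

  partialIso-≡ : ∀ X Y {t n} {ρ : Fin n → Point X} {σ : Fin n → Point Y} → 1 ≤ t →
                 PartialIso X Y t ρ σ → ∀ i j → ρ i ≡ ρ j → σ i ≡ σ j
  partialIso-≡ X Y {t} {ρ = ρ} {σ} 1≤t iso i j ρi≡ρj with _≟_ Y (component Y (σ i)) (component Y (σ j))
  ... | yes σi~σj = point-ext Y σi~σj (begin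
    coord Y (σ i)  ≡⟨ proj₁ (matched iso i) ⟨
    coord X (ρ i)  ≡⟨ cong (coord X) ρi≡ρj ⟩
    coord X (ρ j)  ≡⟨ proj₁ (matched iso j) ⟩
    coord Y (σ j)  ∎)
    where open ≡-Reasoning
  ... | no σi≁σj = contradiction (ℕP.≤-trans 1≤t (subst (t ≤_) coincide far)) λ ()
    where
    far : t ≤ dist (coord X (ρ i)) (coord X (ρ j))
    far = apart→ iso i j (cong (component X) ρi≡ρj) σi≁σj
    coincide : dist (coord X (ρ i)) (coord X (ρ j)) ≡ 0
    coincide = subst (λ z → dist (coord X (ρ i)) (coord X z) ≡ 0) ρi≡ρj (dist-self (coord X (ρ i)))

  partialIso-⟶ : ∀ X Y {t n} {ρ : Fin n → Point X} {σ : Fin n → Point Y} → 2 ≤ t →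
                 PartialIso X Y t ρ σ → ∀ i j → _⟶_ X (ρ i) (ρ j) → _⟶_ Y (σ i) (σ j)
  partialIso-⟶ X Y {t} {ρ = ρ} {σ} 2≤t iso i j ρi⟶ρj
    with Equivalence.to (⟶⇔ X) ρi⟶ρj
  ... | ρi~ρj , dist≡1 , ¬endpoint with _≟_ Y (component Y (σ i)) (component Y (σ j))
  ... | no σi≁σj = contradiction (ℕP.≤-trans 2≤t (subst (t ≤_) dist≡1 (apart→ iso i j ρi~ρj σi≁σj))) λ { (s≤s ()) }
  ... | yes σi~σj = Equivalence.from (⟶⇔ Y) (σi~σj , dist≡1Y , ¬endpointY)
    where
    ρi≡σi = proj₁ (matched iso i)
    dist≡1Y : dist (coord Y (σ i)) (coord Y (σ j)) ≡ 1
    dist≡1Y = trans (cong₂ dist (sym ρi≡σi) (sym (proj₁ (matched iso j)))) dist≡1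
    ¬endpointY : ¬ Endpoint M (endsOf Y (σ i)) (coord Y (σ i))
    ¬endpointY (e , e∈ , at) = ¬endpoint (e , Equivalence.from (proj₂ (matched iso i) e near) e∈ , trans ρi≡σi at)
      where
      near : dist (coord X (ρ i)) (anchor M e) < t
      near = subst (λ c → dist c (anchor M e) < t) (sym (trans ρi≡σi at))
        (subst (_< t) (sym (dist-self (anchor M e))) (ℕP.≤-trans (s≤s z≤n) 2≤t))

  partialIso-extend : ∀ X Y {t n} {ρ : Fin n → Point X} {σ : Fin n → Point Y} {x y} →
    PartialIso X Y t ρ σ → Matched X Y t x y →
    (∀ i → Apart X Y t x (ρ i) y (σ i)) → (∀ i → Apart Y X t y (σ i) x (ρ i)) →
    PartialIso X Y t (extend (ars X) x ρ) (extend (ars Y) y σ)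
  partialIso-extend X Y {t} {ρ = ρ} {σ} {x} {y} iso x≈y new→ new← = record
    { matched = matchedExt
    ; apart→  = apartExt X Y (apart→ iso) new→
    ; apart←  = apartExt Y X (apart← iso) new←
    }
    where
    matchedExt : ∀ i → Matched X Y t (extend (ars X) x ρ i) (extend (ars Y) y σ i)
    matchedExt zero    = x≈y
    matchedExt (suc i) = matched iso i
    apartExt : ∀ X Y {ρ : Fin _ → Point X} {σ : Fin _ → Point Y} {x y} →
      (∀ i j → Apart X Y t (ρ i) (ρ j) (σ i) (σ j)) → (∀ i → Apart X Y t x (ρ i) y (σ i)) →
      ∀ i j → Apart X Y t (extend (ars X) x ρ i) (extend (ars X) x ρ j) (extend (ars Y) y σ i) (extend (ars Y) y σ j)
    apartExt X Y old new zero    zero    _ y≁y = contradiction refl y≁y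
    apartExt X Y old new zero    (suc j) = new j
    apartExt X Y old new (suc i) zero    = apart-swap X Y (new i)
    apartExt X Y old new (suc i) (suc j) = old i j

  extend-near : ∀ X Y {t n} {ρ : Fin n → Point X} {σ : Fin n → Point Y} →
    PartialIso X Y (t + t) ρ σ →
    ∀ x j → component X (ρ j) ≡ component X x → dist (coord X x) (coord X (ρ j)) < t →
    Σ (Point Y) λ y → PartialIso X Y t (extend (ars X) x ρ) (extend (ars Y) y σ)
  extend-near X Y {t} {ρ = ρ} {σ} iso x j ρj~x x-near = y , partialIso-extend X Y iso-t x≈y new→ new←
    where
    c = coord X x
    ρj≡σj = proj₁ (matched iso j)
    t≤2t = ℕP.m≤m+n t t
    iso-t = partialIso-mono X Y t≤2t iso

    c-near-σj : dist c (coord Y (σ j)) < t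
    c-near-σj = subst (λ d → dist c d < t) ρj≡σj x-near

    ρj-near-anchor : ∀ {e} → dist c (anchor M e) < t → dist (coord X (ρ j)) (anchor M e) < t + t
    ρj-near-anchor {e} near = ℕP.≤-<-trans (dist-triangle (coord X (ρ j)) c (anchor M e))
      (ℕP.+-mono-< (subst (_< t) (dist-sym c (coord X (ρ j))) x-near) near)

    -- If c lies beyond an end of σ j's component, that end is within 2t of σ j,
    -- hence also an end of x's component.
    onSide : ∀ {e} → e ∈ᴱ endsOf Y (σ j) → OnSide M e c
    onSide {e} e∈ with onSide? M e c
    ... | yes c-on = c-on
    ... | no c-off = coord-onSide X x (subst (e ∈ᴱ_) (cong (ends X) ρj~x)
          (Equivalence.from (proj₂ (matched iso j) e ρj-near) e∈))
      where
      ρj-near : dist (coord X (ρ j)) (anchor M e) < t + t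
      ρj-near = subst (λ d → dist d (anchor M e) < t + t) (sym ρj≡σj)
        (ℕP.≤-<-trans (anchor-closer M e c-off (coord-onSide Y (σ j) e∈))
          (ℕP.<-≤-trans (subst (_< t) (dist-sym c _) c-near-σj) t≤2t))

    placed = place Y (component Y (σ j)) c onSide
    y = proj₁ placed
    y~σj = proj₁ (proj₂ placed)
    y-at-c = proj₂ (proj₂ placed)

    x≈y : Matched X Y t x y
    x≈y = sym y-at-c , λ e near →
      subst₂ (λ E E′ → e ∈ᴱ E ⇔ e ∈ᴱ E′) (cong (ends X) ρj~x) (cong (ends Y) (sym y~σj))
        (proj₂ (matched iso j) e (ρj-near-anchor near))

    new→ : ∀ i → Apart X Y t x (ρ i) y (σ i)
    new→ i x~ρi y≁σi = far-from-near (coord X (ρ j)) (coord X (ρ i)) c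
      (apart→ iso j i (trans ρj~x x~ρi) (λ σj~σi → y≁σi (trans y~σj σj~σi))) x-near

    new← : ∀ i → Apart Y X t y (σ i) x (ρ i)
    new← i y~σi x≁ρi = subst (λ d → t ≤ dist d (coord Y (σ i))) (sym y-at-c)
      (far-from-near (coord Y (σ j)) (coord Y (σ i)) c
        (apart← iso j i (trans (sym y~σj) y~σi) (λ ρj~ρi → x≁ρi (trans (sym ρj~x) ρj~ρi))) c-near-σj)

  extend-fresh : ∀ X Y {t n} {ρ : Fin n → Point X} {σ : Fin n → Point Y} →
    t + t ≤ M → PartialIso X Y (t + t) ρ σ →
    ∀ x → (∀ i → component X x ≡ component X (ρ i) → t ≤ dist (coord X x) (coord X (ρ i))) →
    Σ (Point Y) λ y → PartialIso X Y t (extend (ars X) x ρ) (extend (ars Y) y σ)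
  extend-fresh X Y {t} {σ = σ} 2t≤M iso x far =
    y , partialIso-extend X Y (partialIso-mono X Y (ℕP.m≤m+n t t) iso) x≈y (λ i x~ρi _ → far i x~ρi) new←
    where
    c = coord X x
    oneEnded = sameNearEnds-oneEnded 2t≤M (endsOf X x) c
    e₀ = proj₁ oneEnded
    new = fresh Y σ e₀
    k = proj₁ new
    k-ends = proj₁ (proj₂ new)

    onSide : ∀ {e} → e ∈ᴱ ends Y k → OnSide M e c
    onSide e∈ with subst (_ ∈ᴱ_) k-ends e∈
    ... | refl = coord-onSide X x (proj₁ (proj₂ oneEnded))

    placed = place Y k c onSide
    y = proj₁ placed
    y∈k = proj₁ (proj₂ placed)

    x≈y : Matched X Y t x y
    x≈y = sym (proj₂ (proj₂ placed)) , λ e near →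
      subst (λ E → e ∈ᴱ endsOf X x ⇔ e ∈ᴱ E) (sym (trans (cong (ends Y) y∈k) k-ends))
        (proj₂ (proj₂ oneEnded) e near)

    new← : ∀ i → Apart Y X t y (σ i) x _
    new← i y~σi = contradiction (trans (sym y~σi) y∈k) (proj₂ (proj₂ new) i)

  extend-partialIso : ∀ X Y {t n} {ρ : Fin n → Point X} {σ : Fin n → Point Y} →
    t + t ≤ M → PartialIso X Y (t + t) ρ σ →
    ∀ x → Σ (Point Y) λ y → PartialIso X Y t (extend (ars X) x ρ) (extend (ars Y) y σ)
  extend-partialIso X Y {t} {ρ = ρ} 2t≤M iso x
    with any? (λ j → _≟_ X (component X (ρ j)) (component X x) ×-dec (dist (coord X x) (coord X (ρ j)) ℕP.<? t))
  ... | yes (j , ρj~x , near) = extend-near X Y iso x j ρj~x near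
  ... | no ¬near = extend-fresh X Y 2t≤M iso x λ i x~ρi → ℕP.≮⇒≥ λ near → ¬near (i , sym x~ρi , near)

rank : ∀ {n} → Formula n → ℕ
rank ⊥'        = 0
rank ⊤'        = 0
rank (i ≐ j)   = 0
rank (rel i j) = 0
rank (¬' φ)    = rank φ
rank (φ ∧' ψ)  = rank φ ⊔ rank ψ
rank (φ ∨' ψ)  = rank φ ⊔ rank ψ
rank (φ ⇒' ψ)  = rank φ ⊔ rank ψ
rank (∀' φ)    = suc (rank φ)
rank (∃' φ)    = suc (rank φ)

-- Each quantifier halves the threshold, and atomic formulas need threshold 2.
threshold : ℕ → ℕ
threshold zero    = 2
threshold (suc k) = threshold k + threshold k

2≤threshold : ∀ k → 2 ≤ threshold k
2≤threshold zero    = ℕP.≤-refl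
2≤threshold (suc k) = ℕP.≤-trans (2≤threshold k) (ℕP.m≤m+n (threshold k) (threshold k))

threshold-half : ∀ {M} k → threshold (suc k) ≤ M → threshold k ≤ M
threshold-half k = ℕP.≤-trans (ℕP.m≤m+n (threshold k) (threshold k))

module _ {M : ℕ} where
  open LineSystem

  transfer : ∀ (X Y : LineSystem M) {n} (φ : Formula n) k → rank φ ≤ k → threshold k ≤ M →
    ∀ {ρ σ} → PartialIso X Y (threshold k) ρ σ → ⟦_⟧ (ars X) φ ρ → ⟦_⟧ (ars Y) φ σ
  transfer X Y ⊥'        k r t≤M iso ()
  transfer X Y ⊤'        k r t≤M iso _ = tt
  transfer X Y (i ≐ j)   k r t≤M iso ρi≡ρj =
    partialIso-≡ X Y (ℕP.≤-trans (s≤s z≤n) (2≤threshold k)) iso i j ρi≡ρj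
  transfer X Y (rel i j) k r t≤M iso ρi⟶ρj = partialIso-⟶ X Y (2≤threshold k) iso i j ρi⟶ρj
  transfer X Y (¬' φ)    k r t≤M iso ¬φ = λ φY → ¬φ (transfer Y X φ k r t≤M (partialIso-sym X Y iso) φY)
  transfer X Y (φ ∧' ψ)  k r t≤M iso (φX , ψX) =
    transfer X Y φ k (ℕP.m⊔n≤o⇒m≤o _ _ r) t≤M iso φX , transfer X Y ψ k (ℕP.m⊔n≤o⇒n≤o _ _ r) t≤M iso ψX
  transfer X Y (φ ∨' ψ)  k r t≤M iso (inj₁ φX) = inj₁ (transfer X Y φ k (ℕP.m⊔n≤o⇒m≤o _ _ r) t≤M iso φX)
  transfer X Y (φ ∨' ψ)  k r t≤M iso (inj₂ ψX) = inj₂ (transfer X Y ψ k (ℕP.m⊔n≤o⇒n≤o _ _ r) t≤M iso ψX)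
  transfer X Y (φ ⇒' ψ)  k r t≤M iso φ⇒ψ = λ φY →
    transfer X Y ψ k (ℕP.m⊔n≤o⇒n≤o _ _ r) t≤M iso
      (φ⇒ψ (transfer Y X φ k (ℕP.m⊔n≤o⇒m≤o _ _ r) t≤M (partialIso-sym X Y iso) φY))
  transfer X Y (∀' φ) (suc k) (s≤s r) 2t≤M iso ∀φ = λ y →
    let (x , iso′) = extend-partialIso Y X 2t≤M (partialIso-sym X Y iso) y
    in transfer X Y φ k r (threshold-half k 2t≤M) (partialIso-sym Y X iso′) (∀φ x)
  transfer X Y (∃' φ) (suc k) (s≤s r) 2t≤M iso (x , φx) =
    let (y , iso′) = extend-partialIso X Y 2t≤M iso x
    in y , transfer X Y φ k r (threshold-half k 2t≤M) iso′ φx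

strictUpperBound : ∀ {n} (f : Fin n → ℕ) → Σ ℕ λ b → ∀ i → f i < b
strictUpperBound {zero}  f = 0 , λ ()
strictUpperBound {suc n} f = suc (f zero) + b , bounded
  where
  tail = strictUpperBound (λ i → f (suc i))
  b = proj₁ tail
  bounded : ∀ i → f i < suc (f zero) + b
  bounded zero    = ℕP.m≤m+n (suc (f zero)) b
  bounded (suc i) = ℕP.<-≤-trans (proj₂ tail i) (ℕP.m≤n+m b (suc (f zero)))

-- A ray ending at e is placed on the side of anchor e, at distance depth from it.
rayCoord : ℕ → End → ℕ → ℤ
rayCoord M left  d = + d
rayCoord M right d = + M - + d

module _ (M : ℕ) where

  rayCoord-onSide : ∀ e d → OnSide M e (rayCoord M e d)
  rayCoord-onSide left  d = ℤ.+≤+ z≤n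
  rayCoord-onSide right d = ℤP.i-j≤i (+ M) (+ d)

  rayCoord-surjective : ∀ e c → OnSide M e c → Σ ℕ λ d → rayCoord M e d ≡ c
  rayCoord-surjective left  (+ d) _ = d , refl
  rayCoord-surjective right c c≤M =
    ∣ + M - c ∣ , trans (cong (+ M -_) (ℤP.0≤i⇒+∣i∣≡i (ℤP.i≤j⇒0≤j-i c≤M))) (reflect-involutive (+ M) c)

  rayCoord-injective : ∀ e {d d′} → rayCoord M e d ≡ rayCoord M e d′ → d ≡ d′
  rayCoord-injective left  eq = ℤP.+-injective eq
  rayCoord-injective right {d} {d′} eq = ℤP.+-injective (begin
    + d                ≡⟨ reflect-involutive (+ M) (+ d) ⟨
    + M - (+ M - + d)  ≡⟨ cong (+ M -_) eq ⟩
    + M - (+ M - + d′) ≡⟨ reflect-involutive (+ M) (+ d′) ⟩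
    + d′               ∎)
    where open ≡-Reasoning

  dist-rayCoord : ∀ e d d′ → dist (rayCoord M e d) (rayCoord M e d′) ≡ dist (+ d) (+ d′)
  dist-rayCoord left  d d′ = refl
  dist-rayCoord right d d′ = dist-reflect (+ M) (+ d) (+ d′)

  rayEndpoint⇔ : ∀ e d → Endpoint M (only e) (rayCoord M e d) ⇔ d ≡ 0
  rayEndpoint⇔ e d = mk⇔ (λ { (_ , refl , at) → rayCoord-injective e (trans at (anchor≡rayCoord e)) })
                         (λ { refl → e , refl , sym (anchor≡rayCoord e) })
    where
    anchor≡rayCoord : ∀ e → anchor M e ≡ rayCoord M e 0
    anchor≡rayCoord left  = refl
    anchor≡rayCoord right = sym (ℤP.+-identityʳ (+ M))

record RayPoint : Set where
  constructor ray
  field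
    end   : End
    copy  : ℕ
    depth : ℕ

rayComponent : RayPoint → End × ℕ
rayComponent (ray e k _) = e , k

_⟶ᴿ_ : RayPoint → RayPoint → Set
x ⟶ᴿ y = rayComponent x ≡ rayComponent y × dist (+ RayPoint.depth x) (+ RayPoint.depth y) ≡ 1 × RayPoint.depth x ≢ 0

Rays : ARS
Rays = record { Carrier = RayPoint ; _⟶_ = _⟶ᴿ_ ; nonEmpty = ray left 0 0 }

module _ (M : ℕ) where
  open RayPoint

  rayPointCoord : RayPoint → ℤ
  rayPointCoord x = rayCoord M (end x) (depth x)

  rayPlace : ∀ e k c → OnSide M e c → Σ RayPoint λ x → rayComponent x ≡ (e , k) × rayPointCoord x ≡ c
  rayPlace e k c onSide = ray e k (proj₁ d) , refl , proj₂ d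
    where d = rayCoord-surjective M e c onSide

  rayPoint-ext : ∀ {x y} → rayComponent x ≡ rayComponent y → rayPointCoord x ≡ rayPointCoord y → x ≡ y
  rayPoint-ext {ray e k d} refl eq = cong (ray e k) (rayCoord-injective M e eq)

  rays : LineSystem M
  rays = record
    { Point        = RayPoint
    ; _⟶_          = _⟶ᴿ_
    ; origin       = ray left 0 0
    ; Component    = End × ℕ
    ; _≟_          = ProductP.≡-dec _≟ᴱ_ ℕP._≟_
    ; component    = rayComponent
    ; coord        = rayPointCoord
    ; ends         = λ (e , _) → only e
    ; coord-onSide = λ { (ray e k d) refl → rayCoord-onSide M e d }
    ; place        = λ (e , k) c onSide → rayPlace e k c (onSide refl)
    ; point-ext    = rayPoint-ext
    ; ⟶⇔           = mk⇔ to from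
    ; fresh        = λ σ e → let (b , copy<b) = strictUpperBound (λ i → copy (σ i))
                             in (e , b) , refl , λ i same → ℕP.<-irrefl (cong proj₂ same) (copy<b i)
    }
    where
    RayLineStep : RayPoint → RayPoint → Set
    RayLineStep x y = rayComponent x ≡ rayComponent y × LineStep M (only (end x)) (rayPointCoord x) (rayPointCoord y)
    to : ∀ {x y} → x ⟶ᴿ y → RayLineStep x y
    to {ray e k d} {ray .e .k d′} (refl , dist≡1 , d≢0) =
      refl , trans (dist-rayCoord M e d d′) dist≡1 , λ at → d≢0 (Equivalence.to (rayEndpoint⇔ M e d) at)
    from : ∀ {x y} → RayLineStep x y → x ⟶ᴿ y
    from {ray e k d} {ray .e .k d′} (refl , dist≡1 , ¬at) =
      refl , trans (sym (dist-rayCoord M e d d′)) dist≡1 , λ d≡0 → ¬at (Equivalence.from (rayEndpoint⇔ M e d) d≡0)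

↔*-rayComponent : ∀ {x y} → _↔*_ Rays x y → rayComponent x ≡ rayComponent y
↔*-rayComponent ε                 = refl
↔*-rayComponent (fwd x⟶y ◅ y↔*z) = trans (proj₁ x⟶y) (↔*-rayComponent y↔*z)
↔*-rayComponent (bwd y⟶x ◅ y↔*z) = trans (sym (proj₁ y⟶x)) (↔*-rayComponent y↔*z)

↠-rayComponent : ∀ {x y} → _↠_ Rays x y → rayComponent x ≡ rayComponent y
↠-rayComponent x↠y = ↔*-rayComponent (gmap (λ x → x) fwd x↠y)

rays-IsNF⇒depth≡0 : ∀ {x} → IsNF Rays x → RayPoint.depth x ≡ 0
rays-IsNF⇒depth≡0 {ray e k zero}    _   = refl
rays-IsNF⇒depth≡0 {ray e k (suc d)} ¬⟶ = ⊥-elim (¬⟶ (ray e k d , refl , dist-suc d , λ ()))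

rays-IsNF-unique : ∀ {x y} → IsNF Rays x → IsNF Rays y → rayComponent x ≡ rayComponent y → x ≡ y
rays-IsNF-unique {ray e k _} {ray .e .k _} nf-x nf-y refl =
  cong (ray e k) (trans (rays-IsNF⇒depth≡0 nf-x) (sym (rays-IsNF⇒depth≡0 nf-y)))

rays-descend : ∀ e k d → _↠_ Rays (ray e k d) (ray e k 0)
rays-descend e k zero    = ε
rays-descend e k (suc d) = (refl , dist-suc d , λ ()) ◅ rays-descend e k d

rays-UN : UN Rays
rays-UN a b nf-a nf-b a↔*b = rays-IsNF-unique nf-a nf-b (↔*-rayComponent a↔*b)

rays-UN→ : UN→ Rays
rays-UN→ a b nf-a nf-b (x , x↠a , x↠b) =
  rays-IsNF-unique nf-a nf-b (trans (sym (↠-rayComponent x↠a)) (↠-rayComponent x↠b))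

rays-NFP : NFP Rays
rays-NFP (ray e k d) b nf-b a↔*b =
  subst (_↠_ Rays (ray e k d)) (rays-IsNF-unique bottom-IsNF nf-b (↔*-rayComponent a↔*b)) (rays-descend e k d)
  where
  bottom-IsNF : IsNF Rays (ray e k 0)
  bottom-IsNF (_ , _ , _ , 0≢0) = 0≢0 refl

data SegmentOrRay (M : ℕ) : Set where
  seg   : ∀ c → c ≤ M → SegmentOrRay M
  onRay : RayPoint → SegmentOrRay M

srEnds : Maybe (End × ℕ) → Ends
srEnds nothing        = both
srEnds (just (e , _)) = only e

module _ {M : ℕ} where

  srComponent : SegmentOrRay M → Maybe (End × ℕ)
  srComponent (seg _ _) = nothing
  srComponent (onRay x) = just (rayComponent x)

  srCoord : SegmentOrRay M → ℤ
  srCoord (seg c _) = + c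
  srCoord (onRay x) = rayPointCoord M x

  _⟶ˢ_ : SegmentOrRay M → SegmentOrRay M → Set
  x ⟶ˢ y = srComponent x ≡ srComponent y × LineStep M (srEnds (srComponent x)) (srCoord x) (srCoord y)

  srCopy : SegmentOrRay M → ℕ
  srCopy (seg _ _) = 0
  srCopy (onRay x) = RayPoint.copy x

  srCoord-onSide : ∀ x {e} → e ∈ᴱ srEnds (srComponent x) → OnSide M e (srCoord x)
  srCoord-onSide (seg c c≤M)       {left}  _    = ℤ.+≤+ z≤n
  srCoord-onSide (seg c c≤M)       {right} _    = ℤ.+≤+ c≤M
  srCoord-onSide (onRay (ray e k d))       refl = rayCoord-onSide M e d

  srPlace : ∀ k c → (∀ {e} → e ∈ᴱ srEnds k → OnSide M e c) →
            Σ (SegmentOrRay M) λ x → srComponent x ≡ k × srCoord x ≡ c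
  srPlace nothing        (+ c)     onSide = seg c (ℤP.drop‿+≤+ (onSide {right} tt)) , refl , refl
  srPlace nothing        -[1+ _ ]  onSide = contradiction (onSide {left} tt) λ ()
  srPlace (just (e , k)) c         onSide =
    let (x , x∈k , x-at-c) = rayPlace M e k c (onSide refl) in onRay x , cong just x∈k , x-at-c

  srPoint-ext : ∀ {x y} → srComponent x ≡ srComponent y → srCoord x ≡ srCoord y → x ≡ y
  srPoint-ext {seg c c≤M} {seg c′ c′≤M} _ eq with ℤP.+-injective eq
  ... | refl = cong (seg c) (ℕP.≤-irrelevant c≤M c′≤M)
  srPoint-ext {onRay x} {onRay y} eq₁ eq₂ = cong onRay (rayPoint-ext M (MaybeP.just-injective eq₁) eq₂)

  srFresh : ∀ {n} (σ : Fin n → SegmentOrRay M) e →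
            Σ (Maybe (End × ℕ)) λ k → srEnds k ≡ only e × ∀ i → srComponent (σ i) ≢ k
  srFresh σ e = just (e , b) , refl , λ i → fresh (σ i) (copy<b i)
    where
    b = proj₁ (strictUpperBound (λ i → srCopy (σ i)))
    copy<b = proj₂ (strictUpperBound (λ i → srCopy (σ i)))
    fresh : ∀ x → srCopy x < b → srComponent x ≢ just (e , b)
    fresh (onRay x) copy<b same = ℕP.<-irrefl (cong proj₂ (MaybeP.just-injective same)) copy<b

segmentWithRays : ∀ M → LineSystem M
segmentWithRays M = record
  { Point        = SegmentOrRay M
  ; _⟶_          = _⟶ˢ_
  ; origin       = seg 0 z≤n
  ; Component    = Maybe (End × ℕ)
  ; _≟_          = MaybeP.≡-dec (ProductP.≡-dec _≟ᴱ_ ℕP._≟_)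
  ; component    = srComponent
  ; coord        = srCoord
  ; ends         = srEnds
  ; coord-onSide = srCoord-onSide
  ; place        = srPlace
  ; point-ext    = srPoint-ext
  ; ⟶⇔           = ⇔-id _
  ; fresh        = srFresh
  }

IsNF-↠⇒≡ : ∀ 𝒜 {a b} → IsNF 𝒜 a → _↠_ 𝒜 a b → a ≡ b
IsNF-↠⇒≡ 𝒜 nf ε           = refl
IsNF-↠⇒≡ 𝒜 nf (a⟶x ◅ _) = ⊥-elim (nf (_ , a⟶x))

SegmentWithRays : ℕ → ARS
SegmentWithRays M = LineSystem.ars (segmentWithRays M)

segment-step-up : ∀ {M c} (c<M : c < M) → c ≢ 0 → _⟶ˢ_ {M} (seg c (ℕP.<⇒≤ c<M)) (seg (suc c) c<M)
segment-step-up {M} {c} c<M c≢0 = refl , trans (dist-sym (+ c) (+ suc c)) (dist-suc c) , ¬endpoint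
  where
  ¬endpoint : ¬ Endpoint M both (+ c)
  ¬endpoint (left  , _ , at) = c≢0 (ℤP.+-injective at)
  ¬endpoint (right , _ , at) = ℕP.<-irrefl (ℤP.+-injective at) c<M

segment-climb : ∀ {M} c (c<M : c < M) (1≤M : 1 ≤ M) → _↠_ (SegmentWithRays M) (seg 1 1≤M) (seg (suc c) c<M)
segment-climb zero    c<M 1≤M rewrite ℕP.≤-irrelevant c<M 1≤M = ε
segment-climb (suc c) c<M 1≤M = segment-climb c (ℕP.<⇒≤ c<M) 1≤M ◅◅ (segment-step-up c<M λ ()) ◅ ε

module _ (m : ℕ) where
  private
    M : ℕ
    M = suc (suc m)
    bottom top one : SegmentOrRay M
    bottom = seg 0 z≤n
    top    = seg M ℕP.≤-refl
    one    = seg 1 (s≤s z≤n)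

    bottom-IsNF : IsNF (SegmentWithRays M) bottom
    bottom-IsNF (_ , _ , _ , ¬endpoint) = ¬endpoint (left , tt , refl)

    top-IsNF : IsNF (SegmentWithRays M) top
    top-IsNF (_ , _ , _ , ¬endpoint) = ¬endpoint (right , tt , refl)

    bottom≢top : bottom ≢ top
    bottom≢top eq with ℤP.+-injective (cong srCoord eq)
    ... | ()

    one⟶bottom : _⟶ˢ_ one bottom
    one⟶bottom = refl , dist-suc 0 , ¬endpoint
      where
      ¬endpoint : ¬ Endpoint M both (+ 1)
      ¬endpoint (left  , _ , ())
      ¬endpoint (right , _ , at) with ℤP.+-injective at
      ... | ()

    one↠top : _↠_ (SegmentWithRays M) one top
    one↠top = segment-climb (suc m) ℕP.≤-refl (s≤s z≤n)

    bottom↔*top : _↔*_ (SegmentWithRays M) bottom top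
    bottom↔*top = bwd one⟶bottom ◅ gmap (λ x → x) fwd one↠top

  segment-¬UN : ¬ UN (SegmentWithRays M)
  segment-¬UN un = bottom≢top (un bottom top bottom-IsNF top-IsNF bottom↔*top)

  segment-¬UN→ : ¬ UN→ (SegmentWithRays M)
  segment-¬UN→ un→ = bottom≢top (un→ bottom top bottom-IsNF top-IsNF (one , one⟶bottom ◅ ε , one↠top))

  segment-¬NFP : ¬ NFP (SegmentWithRays M)
  segment-¬NFP nfp =
    bottom≢top (IsNF-↠⇒≡ (SegmentWithRays M) bottom-IsNF (nfp bottom top top-IsNF bottom↔*top))

segment⇒rays : ∀ (φ : Sentence) → _⊨_ (SegmentWithRays (suc (suc (threshold (rank φ))))) φ → _⊨_ Rays φ
segment⇒rays φ = transfer (segmentWithRays M) (rays M) φ (rank φ) ℕP.≤-refl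
  (ℕP.≤-trans (ℕP.n≤1+n _) (ℕP.n≤1+n _)) (partialIso-empty (segmentWithRays M) (rays M))
  where M = suc (suc (threshold (rank φ)))

not-generalisedFO : ∀ P → (∀ m → P (SegmentWithRays (suc (suc m)))) → ¬ P Rays → ¬ GeneralisedFO P
not-generalisedFO P segment-P ¬rays-P (Φ , axiomatises) =
  ¬rays-P (Equivalence.from (axiomatises Rays) λ φ φ∈Φ →
    segment⇒rays φ (Equivalence.to (axiomatises (SegmentWithRays _)) (segment-P _) φ φ∈Φ))

theorem3p6 : ¬ GeneralisedFO ¬UN × ¬ GeneralisedFO ¬UN→ × ¬ GeneralisedFO ¬NFP
theorem3p6 = not-generalisedFO ¬UN  segment-¬UN  (λ ¬un  → ¬un  rays-UN)
           , not-generalisedFO ¬UN→ segment-¬UN→ (λ ¬un→ → ¬un→ rays-UN→)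
           , not-generalisedFO ¬NFP segment-¬NFP (λ ¬nfp → ¬nfp rays-NFP)
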